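{- Let $\Delta$ be a finite regular CW complex and let $M$ be an acyclic matching on the Hasse diagram of its face poset $F(\Delta)$ (equivalently, a discrete Morse function on $\Delta$). Suppose that for each $1\le i\le r$ there is a unique gradient path $\gamma_i$ from a critical cell $\tau_i$ of dimension $d_i$ to a critical cell $\sigma_i$ of dimension $d_i-1$. If there is no permutation $\pi\in S_r$ other than the identity such that for every $1\le i\le r$ there is a gradient path from $\tau_i$ to $\sigma_{\pi(i)}$, then simultaneously reversing the gradient paths $\gamma_1,\dots,\gamma_r$ does not create any directed cycles.
   Context: The face poset $F(\Delta)$ of a regular CW complex is the set of its cells (the empty cell included) ordered by $\sigma<\tau$ iff $\sigma$ lies in the boundary of the closure of $\tau$. A matching $M$ on the Hasse diagram of $F(\Delta)$ is acyclic if the directed graph obtained by orienting each matched edge upward (from lower-dimensional to higher-dimensional cell) and every other Hasse diagram edge downward has no directed cycles. Cells not covered by the matching are critical. A gradient path from a critical cell $\tau$ of dimension $p+1$ to a critical cell $\sigma$ of dimension $p$ is a directed path from $\tau$ to $\sigma$ in this directed graph. Reversing a gradient path means reversing the orientation of all its edges, i.e. the edges of the path that were matched become unmatched and vice versa, so that $\tau$ and $\sigma$ become matched. -}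

module Defs where

open import Level using (0ℓ)
open import Data.Nat using (ℕ; zero; suc)
open import Data.Fin using (Fin)
open import Data.List using (List; []; _∷_; _++_; head; last)
open import Data.List.Relation.Unary.Linked using (Linked)
open import Data.Maybe using (just)
open import Data.Product using (Σ; ∃; ∃₂; _×_; _,_)
open import Data.Sum using (_⊎_)
open import Data.Empty using (⊥)
open import Relation.Nullary using (¬_)
open import Relation.Binary.PropositionalEquality using (_≡_; _≢_)
open import Relation.Binary.Structures using (IsPartialOrder)
open import Relation.Binary.Construct.Closure.Transitive using (TransClosure)

-- The face poset F(Δ) of a finite regular CW complex Δ, abstracted as a
-- finite graded poset with a bottom element (the empty cell).
-- Cells are Fin n; rank = dimension + 1 (so the empty cell has rank 0).
record FacePoset : Set₁ where
  field
    n         : ℕ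
    _≤_       : Fin n → Fin n → Set
    isPO      : IsPartialOrder _≡_ _≤_
    rank      : Fin n → ℕ
    empty     : Fin n
    empty-min : ∀ x → empty ≤ x
    empty-rk  : rank empty ≡ 0

  Cell : Set
  Cell = Fin n

  _<_ : Cell → Cell → Set
  x < y = (x ≤ y) × (x ≢ y)

  _⋖_ : Cell → Cell → Set
  x ⋖ y = (x < y) × (∀ z → x < z → z < y → ⊥)

  field
    graded : ∀ {x y} → x ⋖ y → rank y ≡ suc (rank x)

open FacePoset public

record IsMatching (P : FacePoset) (M : Cell P → Cell P → Set) : Set where
  field
    edge    : ∀ {x y} → M x y → _⋖_ P x y
    uniqUp  : ∀ {x y y′} → M x y → M x y′ → y ≡ y′
    uniqLow : ∀ {x x′ y} → M x y → M x′ y → x ≡ x′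
    noChain : ∀ {x y z} → M x y → M y z → ⊥

module _ (P : FacePoset) where

  -- Directed graph on the Hasse diagram determined by a set U of
  -- "upward" Hasse edges: an edge x ⋖ y is oriented x → y if U x y,
  -- and y → x otherwise.
  ArcFrom : (Cell P → Cell P → Set) → Cell P → Cell P → Set
  ArcFrom U x y = (_⋖_ P x y × U x y) ⊎ (_⋖_ P y x × ¬ U y x)

  HasCycle : (Cell P → Cell P → Set) → Set
  HasCycle A = ∃ λ x → TransClosure A x x

  Acyclic : (Cell P → Cell P → Set) → Set
  Acyclic M = ¬ HasCycle (ArcFrom M)

  Critical : (Cell P → Cell P → Set) → Cell P → Set
  Critical M x = (¬ ∃ λ y → M x y) × (¬ ∃ λ y → M y x)

  GradientPath : (Cell P → Cell P → Set) → Cell P → Cell P → List (Cell P) → Set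
  GradientPath M τ σ ws =
    (head ws ≡ just τ) × (last ws ≡ just σ) × Linked (ArcFrom M) ws

  Consecutive : Cell P → Cell P → List (Cell P) → Set
  Consecutive a b ws = ∃₂ λ xs ys → ws ≡ xs ++ (a ∷ b ∷ ys)

  OnPath : List (Cell P) → Cell P → Cell P → Set
  OnPath ws x y = Consecutive x y ws ⊎ Consecutive y x ws

  OnSomePath : ∀ {r} → (Fin r → List (Cell P)) → Cell P → Cell P → Set
  OnSomePath {r} γ x y = ∃ λ (i : Fin r) → OnPath (γ i) x y

  -- Upward edges after reversing all paths γ i: the matched edges
  -- symmetric-difference the edges lying on the paths.
  ReversedUp : ∀ {r} → (Cell P → Cell P → Set) → (Fin r → List (Cell P))
             → Cell P → Cell P → Set
  ReversedUp M γ x y =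
    (M x y × ¬ OnSomePath γ x y) ⊎ (¬ M x y × OnSomePath γ x y)

{-# OPTIONS --safe #-}
module Submission where

-- Every arc of the reversed orientation is either an old arc lying on none of the paths γᵢ or the
-- reverse of an arc of some γₖ; by acyclicity of the old orientation, a new cycle has arcs of both
-- kinds. Between consecutive reversed arcs, taken from γₖ and then from γₗ, the cycle runs along old
-- arcs, and prolonging this stretch backwards along γₖ and forwards along γₗ gives a gradient path
-- from τₖ to σₗ. It is a detour (a path other than γₖ) when k ≠ l, and also for the stretch through
-- an off-path arc. The detours therefore form a closed walk on the indices, which contains a simple
-- cycle. Shifting each index of that cycle to the next one and fixing all other indices i (which are
-- joined by γᵢ) gives a permutation π with a gradient path from each τᵢ to σ_π(i); π is not the
-- identity since, by uniqueness of the γᵢ, no detour is a loop.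

open import Defs
open import Data.Nat using (ℕ; suc)
open import Data.Fin using (Fin)
open import Data.Fin.Permutation using (Permutation′; _⟨$⟩ʳ_)
open import Data.List using (List)
open import Data.Product using (∃; _×_)
open import Relation.Nullary using (¬_)
open import Relation.Binary.PropositionalEquality using (_≡_)

open import Data.Empty using (⊥-elim)
open import Data.Fin.Permutation using (transpose; _∘ₚ_) renaming (id to idₚ)
import Data.Fin.Permutation.Components as PC
open import Data.Fin.Properties using (_≟_; any?)
open import Data.List using ([]; _∷_; _++_; head; last)
open import Data.List.Membership.Propositional using (_∈_; _∉_)
open import Data.List.Properties using (∷-injectiveˡ; ∷-injectiveʳ)
open import Data.List.Relation.Binary.Subset.Propositional using (_⊆_)
open import Data.List.Relation.Binary.Subset.Propositional.Properties using (∷⁺ʳ)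
open import Data.List.Relation.Unary.All.Properties using (anti-mono; ¬Any⇒All¬; All¬⇒¬Any)
open import Data.List.Relation.Unary.All using ([])
open import Data.List.Relation.Unary.AllPairs using ([]; _∷_)
open import Data.List.Relation.Unary.Any using (here; there)
open import Data.List.Relation.Unary.Linked as Linked using (Linked; []; [-]; _∷_)
open import Data.List.Relation.Unary.Unique.Propositional using (Unique)
open import Data.Maybe using (just)
open import Data.Product using (Σ; ∃₂; _,_; proj₁)
open import Data.Sum using (_⊎_; inj₁; inj₂)
open import Function using (_∘_; flip)
open import Level using (Level)
open import Relation.Binary.Core using (Rel)
open import Relation.Binary.Definitions using (DecidableEquality)
open import Relation.Binary.Structures using (IsPartialOrder)
open import Relation.Binary.PropositionalEquality using (_≢_; refl; sym; trans; cong; subst)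
open import Relation.Binary.Construct.Closure.ReflexiveTransitive using (Star; ε; _◅_; _◅◅_)
open import Relation.Binary.Construct.Closure.Transitive using (TransClosure; [_]; _∷_; _∷ʳ_)
open import Relation.Nullary using (yes; no; Dec)
open import Relation.Nullary.Decidable using (map′; _×-dec_; _⊎-dec_; dec-true; dec-false)

private
  variable
    a ℓ : Level
    A : Set a

last-++ : ∀ (xs : List A) {y ys} → last (xs ++ y ∷ ys) ≡ last (y ∷ ys)
last-++ [] = refl
last-++ (_ ∷ []) = refl
last-++ (_ ∷ x ∷ xs) = last-++ (x ∷ xs)

module _ {R : Rel A ℓ} where

  ⁺⇒⋆ : ∀ {x y} → TransClosure R x y → Star R x y
  ⁺⇒⋆ [ r ] = r ◅ ε
  ⁺⇒⋆ (r ∷ rs) = r ◅ ⁺⇒⋆ rs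

  ◅⋆⇒⁺ : ∀ {x y z} → R x y → Star R y z → TransClosure R x z
  ◅⋆⇒⁺ r ε = [ r ]
  ◅⋆⇒⁺ r (r′ ◅ rs) = r ∷ ◅⋆⇒⁺ r′ rs

  mutual
    vertices : ∀ {x y} → Star R x y → List A
    vertices {x} s = x ∷ successors s

    successors : ∀ {x y} → Star R x y → List A
    successors ε = []
    successors (_ ◅ s) = vertices s

  last-vertices : ∀ {x y} (s : Star R x y) → last (vertices s) ≡ just y
  last-vertices ε = refl
  last-vertices (_ ◅ ε) = refl
  last-vertices (_ ◅ s@(_ ◅ _)) = last-vertices s

  linked-vertices : ∀ {x y} (s : Star R x y) → Linked R (vertices s)
  linked-vertices ε = [-]
  linked-vertices (r ◅ ε) = r ∷ [-]
  linked-vertices (r ◅ s@(_ ◅ _)) = r ∷ linked-vertices s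

  target∈vertices : ∀ {x y} (s : Star R x y) → y ∈ vertices s
  target∈vertices ε = here refl
  target∈vertices (_ ◅ s) = there (target∈vertices s)

  prefixTo : ∀ {x y j} (s : Star R x y) → j ∈ vertices s → Unique (vertices s) →
             Σ (Star R x j) λ t → Unique (vertices t) × vertices t ⊆ vertices s
  prefixTo _ (here refl) _ = ε , [] ∷ [] , ∷⁺ʳ _ (λ ())
  prefixTo ε (there ()) _
  prefixTo (r ◅ s) (there j∈s) (x∉s ∷ s-unique) =
    let t , t-unique , t⊆s = prefixTo s j∈s s-unique
    in r ◅ t , anti-mono t⊆s x∉s ∷ t-unique , ∷⁺ʳ _ t⊆s

  linked⇒star : ∀ {x y} xs → Linked R (x ∷ xs) → last (x ∷ xs) ≡ just y → Star R x y
  linked⇒star [] [-] refl = ε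
  linked⇒star (_ ∷ xs) (r ∷ l) eq = r ◅ linked⇒star xs l eq

  linked⇒star-prefix : ∀ {t b} xs {ys} → Linked R (xs ++ b ∷ ys) →
                       head (xs ++ b ∷ ys) ≡ just t → Star R t b
  linked⇒star-prefix [] _ refl = ε
  linked⇒star-prefix (_ ∷ []) (r ∷ _) refl = r ◅ ε
  linked⇒star-prefix (_ ∷ x ∷ xs) (r ∷ l) refl = r ◅ linked⇒star-prefix (x ∷ xs) l refl

  linked-dropPrefix : ∀ xs {ys} → Linked R (xs ++ ys) → Linked R ys
  linked-dropPrefix [] l = l
  linked-dropPrefix (_ ∷ xs) l = linked-dropPrefix xs (Linked.tail l)

  linked-split : ∀ {t s} xs {b c ys} → Linked R (xs ++ b ∷ c ∷ ys) →
                 head (xs ++ b ∷ c ∷ ys) ≡ just t → last (xs ++ b ∷ c ∷ ys) ≡ just s →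
                 Star R t b × R b c × Star R c s
  linked-split xs {ys = ys} l h e with linked-dropPrefix xs l
  ... | r ∷ l′ = linked⇒star-prefix xs l h , r , linked⇒star ys l′ (trans (sym (last-++ xs)) e)

module _ {R : Rel A ℓ} (_≟ᴬ_ : DecidableEquality A) where

  open import Data.List.Membership.DecPropositional _≟ᴬ_ using (_∈?_)

  SimpleCycle : Set _
  SimpleCycle = ∃₂ λ d e → Σ (Star (flip R) d e) (Unique ∘ vertices) × R d e

  closedWalk⇒simpleCycle : ∀ {k} → TransClosure R k k → SimpleCycle
  closedWalk⇒simpleCycle = extend ε ([] ∷ [])
    where
    close : ∀ {c k j} (s : Star (flip R) c k) → Unique (vertices s) → j ∈ vertices s → R c j → SimpleCycle
    close s s-unique j∈s r = let t , t-unique , _ = prefixTo s j∈s s-unique in _ , _ , (t , t-unique) , r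

    extend : ∀ {c k} (visited : Star (flip R) c k) → Unique (vertices visited) → TransClosure R c k → SimpleCycle
    extend s s-unique [ r ] = close s s-unique (target∈vertices s) r
    extend s s-unique (_∷_ {y = j} r rs) with j ∈? vertices s
    ... | yes j∈s = close s s-unique j∈s r
    ... | no j∉s = extend (r ◅ s) (¬Any⇒All¬ _ j∉s ∷ s-unique) rs

module _ {r : ℕ} where

  transpose-matchˡ : ∀ (i j : Fin r) → PC.transpose i j i ≡ j
  transpose-matchˡ i j rewrite dec-true (i ≟ i) refl = refl

  transpose-matchʳ : ∀ (i j : Fin r) → PC.transpose i j j ≡ i
  transpose-matchʳ i j with j ≟ i
  ... | yes j≡i = j≡i
  ... | no _ rewrite dec-true (j ≟ j) refl = refl

  transpose-fixes : ∀ {i j k : Fin r} → k ≢ i → k ≢ j → PC.transpose i j k ≡ k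
  transpose-fixes {i} {j} {k} k≢i k≢j rewrite dec-false (k ≟ i) k≢i | dec-false (k ≟ j) k≢j = refl

  module _ {R : Rel (Fin r) ℓ} where

    cyclicPermutation : ∀ {d e} (s : Star (flip R) d e) → Unique (vertices s) →
      Σ (Permutation′ r) λ π → π ⟨$⟩ʳ d ≡ e
                             × (∀ x → x ≢ d → π ⟨$⟩ʳ x ≡ x ⊎ R x (π ⟨$⟩ʳ x))
                             × (∀ x → x ∉ vertices s → π ⟨$⟩ʳ x ≡ x)
    cyclicPermutation ε _ = idₚ , refl , (λ _ _ → inj₁ refl) , (λ _ _ → refl)
    cyclicPermutation {d} (_◅_ {j = c} rcd s) (d∉s ∷ s-unique)
      with cyclicPermutation s s-unique
    ... | π′ , π′c≡e , moves′ , fixes′ = π , πd≡e , moves , fixes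
      where
      -- π′ already sends c to e; composing with (d c) makes d the new start.
      π : Permutation′ r
      π = transpose d c ∘ₚ π′

      π′d≡d : π′ ⟨$⟩ʳ d ≡ d
      π′d≡d = fixes′ d (All¬⇒¬Any d∉s)

      πd≡e : π ⟨$⟩ʳ d ≡ _
      πd≡e = trans (cong (π′ ⟨$⟩ʳ_) (transpose-matchˡ d c)) π′c≡e

      moves : ∀ x → x ≢ d → π ⟨$⟩ʳ x ≡ x ⊎ R x (π ⟨$⟩ʳ x)
      moves x x≢d with x ≟ c
      ... | yes refl = inj₂ (subst (R x) (sym (trans (cong (π′ ⟨$⟩ʳ_) (transpose-matchʳ d x)) π′d≡d)) rcd)
      ... | no x≢c = subst (λ y → y ≡ x ⊎ R x y) (sym (cong (π′ ⟨$⟩ʳ_) (transpose-fixes x≢d x≢c)))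
                           (moves′ x x≢c)

      fixes : ∀ x → x ∉ d ∷ vertices s → π ⟨$⟩ʳ x ≡ x
      fixes x x∉ = trans (cong (π′ ⟨$⟩ʳ_) (transpose-fixes (x∉ ∘ here) (λ { refl → x∉ (there (here refl)) })))
                         (fixes′ x (x∉ ∘ there))

    closedWalk⇒permutation : ∀ {k} → TransClosure R k k →
      ∃ λ (π : Permutation′ r) → (∀ i → π ⟨$⟩ʳ i ≡ i ⊎ R i (π ⟨$⟩ʳ i)) × ∃ λ i → R i (π ⟨$⟩ʳ i)
    closedWalk⇒permutation walk with closedWalk⇒simpleCycle _≟_ walk
    ... | d , e , (s , s-unique) , rde with cyclicPermutation s s-unique
    ...   | π , πd≡e , moves , _ = π , moves′ , d , rdπd
      where
      rdπd : R d (π ⟨$⟩ʳ d)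
      rdπd = subst (R d) (sym πd≡e) rde

      moves′ : ∀ i → π ⟨$⟩ʳ i ≡ i ⊎ R i (π ⟨$⟩ʳ i)
      moves′ i with i ≟ d
      ... | yes refl = inj₂ rdπd
      ... | no i≢d = moves i i≢d

module _ (P : FacePoset) (M : Cell P → Cell P → Set) where

  ⋖-asym : ∀ {x y} → _⋖_ P x y → ¬ _⋖_ P y x
  ⋖-asym ((x≤y , x≢y) , _) ((y≤x , _) , _) = x≢y (IsPartialOrder.antisym (isPO P) x≤y y≤x)

  consecutive? : (x y : Cell P) (ws : List (Cell P)) → Dec (Consecutive P x y ws)
  consecutive? x y [] = no λ { ([] , _ , ()) ; (_ ∷ _ , _ , ()) }
  consecutive? x y (_ ∷ []) = no λ { ([] , _ , ()) ; (_ ∷ [] , _ , ()) ; (_ ∷ _ ∷ _ , _ , ()) }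
  consecutive? x y (w ∷ w′ ∷ ws) =
    map′ to from ((x ≟ w ×-dec y ≟ w′) ⊎-dec consecutive? x y (w′ ∷ ws))
    where
    to : (x ≡ w × y ≡ w′) ⊎ Consecutive P x y (w′ ∷ ws) → Consecutive P x y (w ∷ w′ ∷ ws)
    to (inj₁ (refl , refl)) = [] , ws , refl
    to (inj₂ (xs , ys , eq)) = w ∷ xs , ys , cong (w ∷_) eq

    from : Consecutive P x y (w ∷ w′ ∷ ws) → (x ≡ w × y ≡ w′) ⊎ Consecutive P x y (w′ ∷ ws)
    from ([] , _ , eq) = inj₁ (sym (∷-injectiveˡ eq) , sym (∷-injectiveˡ (∷-injectiveʳ eq)))
    from (_ ∷ xs , ys , eq) = inj₂ (xs , ys , ∷-injectiveʳ eq)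

  gradientPath-split : ∀ {t s x y ws} → GradientPath P M t s ws → Consecutive P x y ws →
                       Star (ArcFrom P M) t x × ArcFrom P M x y × Star (ArcFrom P M) y s
  gradientPath-split (h , l , linked) (xs , _ , refl) = linked-split xs linked h l

  consecutive-vertices : ∀ {R : Rel (Cell P) ℓ} {t x y s} (p : Star R t x) (r : R x y) (q : Star R y s) →
                         Consecutive P x y (vertices (p ◅◅ r ◅ q))
  consecutive-vertices ε _ q = [] , successors q , refl
  consecutive-vertices {t = t} (_ ◅ p) r q =
    let xs , ys , eq = consecutive-vertices p r q in t ∷ xs , ys , cong (t ∷_) eq

  star⇒gradientPath : ∀ {x y} (s : Star (ArcFrom P M) x y) → GradientPath P M x y (vertices s)
  star⇒gradientPath s = refl , last-vertices s , linked-vertices s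

  module _ {r : ℕ} (τ σ : Fin r → Cell P) (γ : Fin r → List (Cell P))
           (γ-gradient : ∀ i → GradientPath P M (τ i) (σ i) (γ i)) where

    private
      _⇢_ _⇢′_ : Rel (Cell P) _
      _⇢_ = ArcFrom P M
      _⇢′_ = ArcFrom P (ReversedUp P M γ)

    OffPath : Rel (Cell P) _
    OffPath x y = x ⇢ y × ¬ OnSomePath P γ x y

    Reversed : Rel (Cell P) _
    Reversed x y = ∃ λ k → Consecutive P y x (γ k)

    onSomePath? : ∀ x y → Dec (OnSomePath P γ x y)
    onSomePath? x y = any? λ i → consecutive? x y (γ i) ⊎-dec consecutive? y x (γ i)

    onSomePath-sym : ∀ {x y} → OnSomePath P γ x y → OnSomePath P γ y x
    onSomePath-sym (k , inj₁ xy) = k , inj₂ xy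
    onSomePath-sym (k , inj₂ yx) = k , inj₁ yx

    onPath⇒arc : ∀ {k x y} → Consecutive P x y (γ k) → x ⇢ y
    onPath⇒arc {k} xy = let _ , arc , _ = gradientPath-split (γ-gradient k) xy in arc

    upwardArc⇒matched : ∀ {x y} → _⋖_ P x y → x ⇢ y → M x y
    upwardArc⇒matched _ (inj₁ (_ , m)) = m
    upwardArc⇒matched x⋖y (inj₂ (y⋖x , _)) = ⊥-elim (⋖-asym x⋖y y⋖x)

    downwardArc⇒unmatched : ∀ {x y} → _⋖_ P y x → x ⇢ y → ¬ M y x
    downwardArc⇒unmatched y⋖x (inj₁ (x⋖y , _)) = ⊥-elim (⋖-asym x⋖y y⋖x)
    downwardArc⇒unmatched _ (inj₂ (_ , ¬m)) = ¬m

    classify : ∀ {x y} → x ⇢′ y → OffPath x y ⊎ Reversed x y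
    classify (inj₁ (x⋖y , inj₁ (m , ¬on))) = inj₁ (inj₁ (x⋖y , m) , ¬on)
    classify (inj₁ (_ , inj₂ (_ , k , inj₂ yx))) = inj₂ (k , yx)
    classify (inj₁ (x⋖y , inj₂ (¬m , _ , inj₁ xy))) = ⊥-elim (¬m (upwardArc⇒matched x⋖y (onPath⇒arc xy)))
    classify {x} {y} (inj₂ (y⋖x , ¬up)) with onSomePath? y x
    ... | no ¬on = inj₁ (inj₂ (y⋖x , λ m → ¬up (inj₁ (m , ¬on))) , ¬on ∘ onSomePath-sym)
    ... | yes (k , inj₁ yx) = inj₂ (k , yx)
    ... | yes on@(_ , inj₂ xy) = ⊥-elim (¬up (inj₂ (downwardArc⇒unmatched y⋖x (onPath⇒arc xy) , on)))

    Detour : Rel (Fin r) _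
    Detour i j = ∃ λ ws → GradientPath P M (τ i) (σ j) ws × (i ≡ j → ws ≢ γ i)

    detour-≢ : ∀ {i j} → i ≢ j → Star _⇢_ (τ i) (σ j) → Detour i j
    detour-≢ i≢j s = vertices s , star⇒gradientPath s , ⊥-elim ∘ i≢j

    detour-offPath : ∀ {i j u v} → Star _⇢_ (τ i) u → OffPath u v → Star _⇢_ v (σ j) → Detour i j
    detour-offPath {i} {u = u} {v} p (arc , ¬on) q = vertices walk , star⇒gradientPath walk , walk≢γi
      where
      walk = p ◅◅ arc ◅ q

      walk≢γi : _ → vertices walk ≢ γ i
      walk≢γi _ walk≡γi = ¬on (i , inj₁ (subst (Consecutive P u v) walk≡γi (consecutive-vertices p arc q)))

    follow : ∀ {i v u} → Star _⇢_ (τ i) v → Star _⇢′_ v u → ∃ λ j → Star Detour i j × Star _⇢_ (τ j) u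
    follow walk ε = _ , ε , walk
    follow {i} walk (a ◅ rest) with classify a
    ... | inj₁ (arc , _) = follow (walk ◅◅ arc ◅ ε) rest
    ... | inj₂ (k , onγk) with gradientPath-split (γ-gradient k) onγk | i ≟ k
    ...   | toStart , _ , _     | yes refl = follow toStart rest
    ...   | toStart , _ , toEnd | no i≢k =
      let j , detours , toU = follow toStart rest in j , detour-≢ i≢k (walk ◅◅ toEnd) ◅ detours , toU

    offPathArc-or-reversed : ∀ {x y} → TransClosure _⇢′_ x y →
      TransClosure _⇢_ y x ⊎ ∃₂ λ u v → Star _⇢′_ x u × OffPath u v × Star _⇢′_ v y
    offPathArc-or-reversed [ a ] with classify a
    ... | inj₁ off = inj₂ (_ , _ , ε , off , ε)
    ... | inj₂ (_ , onγk) = inj₁ [ onPath⇒arc onγk ]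
    offPathArc-or-reversed (a ∷ rest) with classify a | offPathArc-or-reversed rest
    ... | inj₁ off | _ = inj₂ (_ , _ , ε , off , ⁺⇒⋆ rest)
    ... | inj₂ (_ , onγk) | inj₁ back = inj₁ (back ∷ʳ onPath⇒arc onγk)
    ... | inj₂ _ | inj₂ (u , v , pre , off , post) = inj₂ (u , v , a ◅ pre , off , post)

    firstReversed : ∀ {x y} → Star _⇢′_ x y →
      Star _⇢_ x y ⊎ ∃₂ λ u v → Star _⇢_ x u × Reversed u v × Star _⇢′_ v y
    firstReversed ε = inj₁ ε
    firstReversed (a ◅ rest) with classify a | firstReversed rest
    ... | inj₂ rev | _ = inj₂ (_ , _ , ε , rev , rest)
    ... | inj₁ (arc , _) | inj₁ walk = inj₁ (arc ◅ walk)
    ... | inj₁ (arc , _) | inj₂ (u , v , pre , rev , post) = inj₂ (u , v , arc ◅ pre , rev , post)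

    cycle⇒closedDetourWalk : Acyclic P M → HasCycle P _⇢′_ → ∃ λ k → TransClosure Detour k k
    cycle⇒closedDetourWalk acyclic (x , cycle) with offPathArc-or-reversed cycle
    ... | inj₁ back = ⊥-elim (acyclic (x , back))
    ... | inj₂ (u , v , pre , off , post) with firstReversed (post ◅◅ pre)
    ...   | inj₁ walk = ⊥-elim (acyclic (u , ◅⋆⇒⁺ (proj₁ off) walk))
    ...   | inj₂ (b , c , toB , (k , onγk) , rest) with gradientPath-split (γ-gradient k) onγk
    ...     | toC , _ , fromB with follow toC rest
    ...       | j , detours , toU = j , ◅⋆⇒⁺ (detour-offPath toU off (toB ◅◅ fromB)) detours

    closedDetourWalk-impossible :
      (∀ i ws → GradientPath P M (τ i) (σ i) ws → ws ≡ γ i) →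
      (∀ (π : Permutation′ r) → (∀ i → ∃ λ ws → GradientPath P M (τ i) (σ (π ⟨$⟩ʳ i)) ws) →
        ∀ i → π ⟨$⟩ʳ i ≡ i) →
      ∀ {k} → ¬ TransClosure Detour k k
    closedDetourWalk-impossible γ-unique only-identity walk with closedWalk⇒permutation walk
    ... | π , moves , i , (ws , path , ws≢γi) =
      ws≢γi (sym πi≡i) (γ-unique i ws (subst (λ j → GradientPath P M (τ i) (σ j) ws) πi≡i path))
      where
      reach : ∀ i → ∃ λ ws → GradientPath P M (τ i) (σ (π ⟨$⟩ʳ i)) ws
      reach i with moves i
      ... | inj₁ fixed = γ i , subst (λ j → GradientPath P M (τ i) (σ j) (γ i)) (sym fixed) (γ-gradient i)
      ... | inj₂ (ws , path , _) = ws , path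

      πi≡i : π ⟨$⟩ʳ i ≡ i
      πi≡i = only-identity π reach i

proposition2p1 : (P : FacePoset) (M : Cell P → Cell P → Set) → IsMatching P M → Acyclic P M →
    (r : ℕ) (τ σ : Fin r → Cell P) (γ : Fin r → List (Cell P)) →
    (∀ i → Critical P M (τ i)) → (∀ i → Critical P M (σ i)) →
    (∀ i → rank P (τ i) ≡ suc (rank P (σ i))) →
    (∀ i → GradientPath P M (τ i) (σ i) (γ i)) →
    (∀ i ws → GradientPath P M (τ i) (σ i) ws → ws ≡ γ i) →
    (∀ (π : Permutation′ r) →
    (∀ i → ∃ λ ws → GradientPath P M (τ i) (σ (π ⟨$⟩ʳ i)) ws) →
    ∀ i → π ⟨$⟩ʳ i ≡ i) →
    ¬ HasCycle P (ArcFrom P (ReversedUp P M γ))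
proposition2p1 P M _ acyclic r τ σ γ _ _ _ γ-gradient γ-unique only-identity cycle =
  let k , detourWalk = cycle⇒closedDetourWalk P M τ σ γ γ-gradient acyclic cycle
  in closedDetourWalk-impossible P M τ σ γ γ-gradient γ-unique only-identity detourWalk
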